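{- Let $F$ be a recursively enumerable formal system in which infinitely many different theorems can be proved, and let $\mathcal{G}_F$ be as in the context. Then $F$ is consistent if and only if $\operatorname{Ldim}(\mathcal{G}_F)<\infty$.
   Context: Let $\mathbb{N}=\{0,1,2,\dots\}$. A formal system $F$ is consistent if no well-formed statement is provable together with its negation. Fix a Gödel numbering in which translating statements and forming negations is primitive recursive; theorems are different iff their Gödel numbers differ. $F$ is recursively enumerable if there is a primitive recursive $\varphi:\mathbb{N}\to\mathbb{N}$ whose range is exactly the set of Gödel numbers of statements provable in $F$; fix such $\varphi$. Let $E^2:\mathbb{N}\to\mathbb{N}\times\mathbb{N}$ be a bijection with primitive recursive components $E^2_1,E^2_2$ and primitive recursive inverse. Let $c_c(\{0,1\})$ be the set of finitely supported $a:\mathbb{N}\to\{0,1\}$. For such $a$ let $g_a(n)=a(n)$ if the statement with Gödel number $\varphi(E^2_1(n))$ is the negation of the statement with Gödel number $\varphi(E^2_2(n))$, and $g_a(n)=0$ otherwise; $\mathcal{G}_F=\{g_a: a\in c_c(\{0,1\})\}$. A family $\{x_{\mathbf v}\}_{\mathbf v\in\{0,1\}^k, 0\le k<d}$ indexed by nodes of a complete binary tree is a Littlestone tree of depth $d\le\infty$ of $\mathcal{G}$ if for every $y_1,y_2,\dots\in\{0,1\}$ and every $0\le n<d$ there is $g\in\mathcal{G}$ with $g(x_{y_1\dots y_k})=y_{k+1}$ for all $0\le k\le n$. $\operatorname{Ldim}(\mathcal{G})=\sup\{d\in\mathbb{N}: \mathcal{G}\text{ has a Littlestone tree of depth }d\}$.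 -}

module Defs where

open import Data.Nat using (ℕ; zero; suc; _≤_; _<_; _≟_)
open import Data.Fin using (Fin)
open import Data.Vec using (Vec; []; _∷_; lookup)
open import Data.Bool using (Bool; true; false; if_then_else_)
open import Data.List using (List; []; _∷_)
open import Data.Product using (Σ; ∃; _×_; _,_)
open import Relation.Nullary using (¬_)
open import Relation.Nullary.Decidable using (⌊_⌋)
open import Relation.Binary.PropositionalEquality using (_≡_)
open import Function.Bundles using (_⇔_)

data PR : ℕ → Set where
  cz   : ∀ {k} → PR k
  succ : PR 1
  proj : ∀ {k} → Fin k → PR k
  comp : ∀ {k m} → PR m → Vec (PR k) m → PR k
  prec : ∀ {k} → PR k → PR (suc (suc k)) → PR (suc k)

mutual
  eval : ∀ {k} → PR k → Vec ℕ k → ℕ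
  eval cz xs = 0
  eval succ (x ∷ []) = suc x
  eval (proj i) xs = lookup xs i
  eval (comp f gs) xs = eval f (evalVec gs xs)
  eval (prec f g) (n ∷ xs) = evalRec f g n xs

  evalVec : ∀ {k m} → Vec (PR k) m → Vec ℕ k → Vec ℕ m
  evalVec [] xs = []
  evalVec (g ∷ gs) xs = eval g xs ∷ evalVec gs xs

  evalRec : ∀ {k} → PR k → PR (suc (suc k)) → ℕ → Vec ℕ k → ℕ
  evalRec f g zero xs = eval f xs
  evalRec f g (suc n) xs = eval g (n ∷ evalRec f g n xs ∷ xs)

IsPrimRec₁ : (ℕ → ℕ) → Set
IsPrimRec₁ f = Σ (PR 1) λ c → ∀ x → eval c (x ∷ []) ≡ f x

IsPrimRec₂ : (ℕ → ℕ → ℕ) → Set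
IsPrimRec₂ f = Σ (PR 2) λ c → ∀ x y → eval c (x ∷ y ∷ []) ≡ f x y

-- Formal systems, viewed through a fixed Gödel numbering.
-- Statements are identified with their Gödel numbers (different theorems
-- iff different Gödel numbers).

record FormalSystem : Set₁ where
  field
    WF        : ℕ → Set
    Provable  : ℕ → Set
    provable-wf : ∀ m → Provable m → WF m
    neg       : ℕ → ℕ
    neg-wf    : ∀ m → WF m → WF (neg m)
    neg-pr    : IsPrimRec₁ neg
    explosion : (Σ ℕ λ m → WF m × Provable m × Provable (neg m)) →
                ∀ m → WF m → Provable m

open FormalSystem public

Consistent : FormalSystem → Set
Consistent F = ¬ (Σ ℕ λ m → WF F m × Provable F m × Provable F (neg F m))

-- infinitely many different theorems: the set of Gödel numbers of
-- provable statements is unbounded (= infinite subset of ℕ)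
InfinitelyManyTheorems : FormalSystem → Set
InfinitelyManyTheorems F = ∀ N → Σ ℕ λ m → N ≤ m × Provable F m

record REnumeration (F : FormalSystem) : Set where
  field
    φ       : ℕ → ℕ
    φ-pr    : IsPrimRec₁ φ
    φ-range : ∀ m → Provable F m ⇔ (Σ ℕ λ i → φ i ≡ m)

open REnumeration public

record PairingPR : Set where
  field
    E₁ : ℕ → ℕ
    E₂ : ℕ → ℕ
    inv : ℕ → ℕ → ℕ
    E₁-pr : IsPrimRec₁ E₁
    E₂-pr : IsPrimRec₁ E₂
    inv-pr : IsPrimRec₂ inv
    inv-left  : ∀ n → inv (E₁ n) (E₂ n) ≡ n
    inv-right : ∀ i j → E₁ (inv i j) ≡ i × E₂ (inv i j) ≡ j

open PairingPR public

FinitelySupported : (ℕ → Bool) → Set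
FinitelySupported a = Σ ℕ λ N → ∀ n → N ≤ n → a n ≡ false

g[_,_,_] : (F : FormalSystem) → REnumeration F → PairingPR → (ℕ → Bool) → ℕ → Bool
g[ F , e , E ] a n =
  if ⌊ φ e (E₁ E n) ≟ neg F (φ e (E₂ E n)) ⌋ then a n else false

𝒢 : (F : FormalSystem) → REnumeration F → PairingPR → (ℕ → Bool) → Set
𝒢 F e E g = Σ (ℕ → Bool) λ a → FinitelySupported a × (∀ n → g n ≡ g[ F , e , E ] a n)

-- the node x_{y₁…y_k}: the first k entries of the sequence y (0-indexed)
prefix : ℕ → (ℕ → Bool) → List Bool
prefix zero y = []
prefix (suc k) y = y 0 ∷ prefix k (λ i → y (suc i))

-- a tree is a labelling of nodes (finite binary words) by points of ℕ;
-- only nodes of length < d matter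
IsLittlestoneTree : ((ℕ → Bool) → Set) → ℕ → (List Bool → ℕ) → Set
IsLittlestoneTree 𝒞 d x =
  ∀ (y : ℕ → Bool) (n : ℕ) → n < d →
    Σ (ℕ → Bool) λ g → 𝒞 g × (∀ k → k ≤ n → g (x (prefix k y)) ≡ y k)

HasLittlestoneTree : ((ℕ → Bool) → Set) → ℕ → Set
HasLittlestoneTree 𝒞 d = Σ (List Bool → ℕ) (IsLittlestoneTree 𝒞 d)

LdimFinite : ((ℕ → Bool) → Set) → Set
LdimFinite 𝒞 = Σ ℕ λ D → ∀ d → HasLittlestoneTree 𝒞 d → d ≤ D

module Submission where

open import Defs
open import Function.Base using (_∘_)
open import Function.Bundles using (_⇔_; mk⇔; Equivalence)
open import Data.Nat using (ℕ; zero; suc; _≤_; _<_; _≟_; z≤n; s≤s; z<s; _⊔_)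
open import Data.Nat.Properties
open import Data.Bool using (Bool; true; false)
open import Data.List using (List; length)
open import Data.Product using (Σ; _×_; _,_; proj₁; proj₂)
open import Data.Sum using (inj₁; inj₂)
open import Data.Empty using (⊥-elim)
open import Relation.Nullary using (¬_; yes; no)
open import Relation.Binary using (tri<; tri≈; tri>)
open import Relation.Binary.PropositionalEquality

-- If F is consistent, no two enumerated theorems are a statement and its
-- negation, so every g_a vanishes and 𝒢_F has no Littlestone tree of depth 1.
-- If F is inconsistent, every statement is provable, so each of the
-- infinitely many theorems s yields an index n with φ(E²₁ n) = ¬ s and
-- φ(E²₂ n) = s; these contradictory indices form an infinite set on which
-- g_a agrees with a. Enumerating them as p₀ < p₁ < …, the tree whose nodes
-- of depth k are all labelled p_k is shattered by 𝒢_F to every finite depth.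

LdimFinite-if-allFalse : {𝒞 : (ℕ → Bool) → Set} →
  (∀ g → 𝒞 g → ∀ n → g n ≡ false) → LdimFinite 𝒞
LdimFinite-if-allFalse {𝒞} allFalse = 0 , depth≤0
  where
  depth≤0 : ∀ d → HasLittlestoneTree 𝒞 d → d ≤ 0
  depth≤0 zero    _       = z≤n
  depth≤0 (suc d) (x , T) with T (λ _ → true) 0 z<s
  ... | g , g∈𝒞 , agrees with () ← trans (sym (allFalse g g∈𝒞 (x _))) (agrees 0 z≤n)

¬LdimFinite-if-allDepths : {𝒞 : (ℕ → Bool) → Set} →
  (∀ d → HasLittlestoneTree 𝒞 d) → ¬ LdimFinite 𝒞
¬LdimFinite-if-allDepths trees (D , bound) = 1+n≰n (bound (suc D) (trees (suc D)))

length-prefix : ∀ k y → length (prefix k y) ≡ k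
length-prefix zero    y = refl
length-prefix (suc k) y = cong suc (length-prefix k (λ i → y (suc i)))

Unbounded : (ℕ → Set) → Set
Unbounded P = ∀ N → Σ ℕ λ n → N ≤ n × P n

unbounded-if-imageUnbounded : (f : ℕ → ℕ) {P : ℕ → Set} →
  (∀ M → Σ ℕ λ n → P n × M < f n) → Unbounded P
unbounded-if-imageUnbounded f {P} large N with beyond N 0
  where
  -- A witness exceeding M ⊔ f N cannot be N itself.
  beyond : ∀ N M → Σ ℕ λ n → N ≤ n × P n × M < f n
  beyond zero M with large M
  ... | n , Pn , M<fn = n , z≤n , Pn , M<fn
  beyond (suc N) M with beyond N (M ⊔ f N)
  ... | n , N≤n , Pn , M⊔fN<fn = n , ≤∧≢⇒< N≤n N≢n , Pn , m⊔n<o⇒m<o M (f N) M⊔fN<fn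
    where
    N≢n : N ≢ n
    N≢n refl = <-irrefl refl (m⊔n<o⇒n<o M (f N) M⊔fN<fn)
... | n , N≤n , Pn , _ = n , N≤n , Pn

module Enumeration {P : ℕ → Set} (unbounded : Unbounded P) where

  enum : ℕ → ℕ
  enum zero    = proj₁ (unbounded 0)
  enum (suc k) = proj₁ (unbounded (suc (enum k)))

  enum-∈ : ∀ k → P (enum k)
  enum-∈ zero    = proj₂ (proj₂ (unbounded 0))
  enum-∈ (suc k) = proj₂ (proj₂ (unbounded (suc (enum k))))

  enum-<-suc : ∀ k → enum k < enum (suc k)
  enum-<-suc k = proj₁ (proj₂ (unbounded (suc (enum k))))

  enum-strictMono : ∀ {k j} → k < j → enum k < enum j
  enum-strictMono {k} {suc j} (s≤s k≤j) with m≤n⇒m<n∨m≡n k≤j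
  ... | inj₁ k<j  = <-trans (enum-strictMono k<j) (enum-<-suc j)
  ... | inj₂ refl = enum-<-suc k

  enum-injective : ∀ {k j} → enum k ≡ enum j → k ≡ j
  enum-injective {k} {j} eq with <-cmp k j
  ... | tri< k<j _ _ = ⊥-elim (<⇒≢ (enum-strictMono k<j) eq)
  ... | tri≈ _ k≡j _ = k≡j
  ... | tri> _ _ j<k = ⊥-elim (<⇒≢ (enum-strictMono j<k) (sym eq))

  pathLabelling : (ℕ → Bool) → ℕ → ℕ → Bool
  pathLabelling y zero    m = false
  pathLabelling y (suc n) m with m ≟ enum n
  ... | yes _ = y n
  ... | no  _ = pathLabelling y n m

  pathLabelling-beyond : ∀ y n m → enum n ≤ m → pathLabelling y n m ≡ false
  pathLabelling-beyond y zero    m _ = refl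
  pathLabelling-beyond y (suc n) m enum[1+n]≤m with m ≟ enum n
  ... | yes refl = ⊥-elim (<⇒≱ (enum-<-suc n) enum[1+n]≤m)
  ... | no  _    = pathLabelling-beyond y n m (≤-trans (<⇒≤ (enum-<-suc n)) enum[1+n]≤m)

  pathLabelling-finitelySupported : ∀ y n → FinitelySupported (pathLabelling y n)
  pathLabelling-finitelySupported y n = enum n , pathLabelling-beyond y n

  pathLabelling-at : ∀ y {n k} → k < n → pathLabelling y n (enum k) ≡ y k
  pathLabelling-at y {suc n} {k} (s≤s k≤n) with enum k ≟ enum n
  ... | yes eq = cong y (sym (enum-injective eq))
  ... | no  ne = pathLabelling-at y (≤∧≢⇒< k≤n (ne ∘ cong enum))

Realises : ((ℕ → Bool) → Set) → (ℕ → Set) → Set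
Realises 𝒞 P = ∀ a → FinitelySupported a →
  Σ (ℕ → Bool) λ g → 𝒞 g × (∀ n → P n → g n ≡ a n)

hasLittlestoneTree-if-realises : {𝒞 : (ℕ → Bool) → Set} {P : ℕ → Set} →
  Unbounded P → Realises 𝒞 P → ∀ d → HasLittlestoneTree 𝒞 d
hasLittlestoneTree-if-realises {𝒞} unbounded realises d = depthLabel , shattered
  where
  open Enumeration unbounded
  open ≡-Reasoning

  depthLabel : List Bool → ℕ
  depthLabel = enum ∘ length

  shattered : IsLittlestoneTree 𝒞 d depthLabel
  shattered y n _ with realises (pathLabelling y (suc n)) (pathLabelling-finitelySupported y (suc n))
  ... | g , g∈𝒞 , agrees = g , g∈𝒞 , λ k k≤n → begin
    g (depthLabel (prefix k y))       ≡⟨ cong (g ∘ enum) (length-prefix k y) ⟩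
    g (enum k)                        ≡⟨ agrees (enum k) (enum-∈ k) ⟩
    pathLabelling y (suc n) (enum k)  ≡⟨ pathLabelling-at y (s≤s k≤n) ⟩
    y k                               ∎

module _ (F : FormalSystem) (e : REnumeration F) (E : PairingPR) where

  Contradictory : ℕ → Set
  Contradictory n = φ e (E₁ E n) ≡ neg F (φ e (E₂ E n))

  Inconsistency : Set
  Inconsistency = Σ ℕ λ m → WF F m × Provable F m × Provable F (neg F m)

  enumerated-provable : ∀ i → Provable F (φ e i)
  enumerated-provable i = Equivalence.from (φ-range e (φ e i)) (i , refl)

  ¬contradictory-if-consistent : Consistent F → ∀ n → ¬ Contradictory n
  ¬contradictory-if-consistent consistent n contradictory = consistent
    ( φ e (E₂ E n)
    , provable-wf F _ (enumerated-provable (E₂ E n))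
    , enumerated-provable (E₂ E n)
    , subst (Provable F) contradictory (enumerated-provable (E₁ E n)) )

  g-false-if-consistent : Consistent F → ∀ a n → g[ F , e , E ] a n ≡ false
  g-false-if-consistent consistent a n with φ e (E₁ E n) ≟ neg F (φ e (E₂ E n))
  ... | yes contradictory = ⊥-elim (¬contradictory-if-consistent consistent n contradictory)
  ... | no  _             = refl

  g-contradictory : ∀ a {n} → Contradictory n → g[ F , e , E ] a n ≡ a n
  g-contradictory a {n} contradictory with φ e (E₁ E n) ≟ neg F (φ e (E₂ E n))
  ... | yes _             = refl
  ... | no  ¬contradictory = ⊥-elim (¬contradictory contradictory)

  𝒢-realises : Realises (𝒢 F e E) Contradictory
  𝒢-realises a finite = g[ F , e , E ] a , (a , finite , λ _ → refl) , λ _ → g-contradictory a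

  contradictoryIndex : Inconsistency → ∀ s → Provable F s →
    Σ ℕ λ n → Contradictory n × φ e (E₂ E n) ≡ s
  contradictoryIndex inconsistency s ⊢s
    with Equivalence.to (φ-range e (neg F s)) ⊢¬s | Equivalence.to (φ-range e s) ⊢s
    where
    ⊢¬s : Provable F (neg F s)
    ⊢¬s = explosion F inconsistency (neg F s) (neg-wf F s (provable-wf F s ⊢s))
  ... | i , φi≡¬s | j , φj≡s with inv-right E i j
  ... | E₁n≡i , E₂n≡j = n , contradictory , φE₂n≡s
    where
    open ≡-Reasoning
    n : ℕ
    n = inv E i j

    φE₂n≡s : φ e (E₂ E n) ≡ s
    φE₂n≡s = trans (cong (φ e) E₂n≡j) φj≡s

    contradictory : Contradictory n
    contradictory = begin
      φ e (E₁ E n)            ≡⟨ cong (φ e) E₁n≡i ⟩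
      φ e i                   ≡⟨ φi≡¬s ⟩
      neg F s                 ≡⟨ cong (neg F) (sym φE₂n≡s) ⟩
      neg F (φ e (E₂ E n))    ∎

  contradictory-unbounded : Inconsistency → InfinitelyManyTheorems F → Unbounded Contradictory
  contradictory-unbounded inconsistency infinite = unbounded-if-imageUnbounded (φ e ∘ E₂ E) large
    where
    large : ∀ M → Σ ℕ λ n → Contradictory n × M < φ e (E₂ E n)
    large M with infinite (suc M)
    ... | s , M<s , ⊢s with contradictoryIndex inconsistency s ⊢s
    ... | n , contradictory , φE₂n≡s = n , contradictory , subst (M <_) (sym φE₂n≡s) M<s

proposition4p5 : (F : FormalSystem) (e : REnumeration F) (E : PairingPR) →
    InfinitelyManyTheorems F →
    Consistent F ⇔ LdimFinite (𝒢 F e E)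
proposition4p5 F e E infinite = mk⇔ consistent⇒LdimFinite LdimFinite⇒consistent
  where
  consistent⇒LdimFinite : Consistent F → LdimFinite (𝒢 F e E)
  consistent⇒LdimFinite consistent = LdimFinite-if-allFalse λ where
    _ (a , _ , g≗g[a]) n → trans (g≗g[a] n) (g-false-if-consistent F e E consistent a n)

  LdimFinite⇒consistent : LdimFinite (𝒢 F e E) → Consistent F
  LdimFinite⇒consistent ldimFinite inconsistency =
    ¬LdimFinite-if-allDepths
      (hasLittlestoneTree-if-realises
        (contradictory-unbounded F e E inconsistency infinite) (𝒢-realises F e E))
      ldimFinite
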